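{- Let $P$ be a two-dimensional poset of width $w$ with realizers $L_1, L_2$. Then there is a queue layout of the cover graph of $P$ in at most $w(w+1)/2$ queues whose vertex order is either $L_1$ or $L_2$.
   Context: A poset $P=(X,<)$ is a finite set with a transitive, asymmetric relation; its width is the maximum number of pairwise incomparable elements. A cover relation $a\prec b$ means $a<b$ with no $c$ satisfying $a<c<b$; the cover graph of $P$ has vertex set $X$ and an edge $\{a,b\}$ for each cover relation. A linear extension is a total order $L$ of $X$ with $a<_L b$ whenever $a<_P b$. $P$ is two-dimensional with realizers $L_1,L_2$ if $L_1,L_2$ are linear extensions such that $a<b$ in $P$ iff $a<b$ in both $L_1$ and $L_2$ (and $P$ is not a chain-free-of-dimension-1 case is not required). Given a vertex order $\sigma$, two edges $(u,v),(a,b)$ nest if $u<_\sigma a<_\sigma b<_\sigma v$; a $k$-queue layout with order $\sigma$ is a partition of the edges into $k$ sets (queues) none of which contains two nesting edges. -}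

module Defs where

open import Data.Nat using (ℕ; _≤_)
open import Data.Fin using (Fin)
open import Data.Fin.Subset using (Subset; _∈_; ∣_∣)
open import Data.Product using (_×_; ∃)
open import Data.Sum using (_⊎_)
open import Relation.Nullary using (¬_)
open import Relation.Binary.PropositionalEquality using (_≡_)
open import Relation.Binary.Structures using (IsStrictPartialOrder; IsStrictTotalOrder)

Rel : ℕ → Set₁
Rel n = Fin n → Fin n → Set

IsPoset : ∀ {n} → Rel n → Set
IsPoset _<_ = IsStrictPartialOrder _≡_ _<_

IsLinearOrder : ∀ {n} → Rel n → Set
IsLinearOrder L = IsStrictTotalOrder _≡_ L

IsLinearExtension : ∀ {n} → Rel n → Rel n → Set
IsLinearExtension {n} P L = IsLinearOrder L × (∀ (a b : Fin n) → P a b → L a b)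

IsRealizer : ∀ {n} → Rel n → Rel n → Rel n → Set
IsRealizer {n} P L₁ L₂ =
  IsLinearExtension P L₁ × IsLinearExtension P L₂ ×
  (∀ (a b : Fin n) → (P a b → L₁ a b × L₂ a b) × (L₁ a b × L₂ a b → P a b))

IsAntichain : ∀ {n} → Rel n → Subset n → Set
IsAntichain {n} P A = ∀ (a b : Fin n) → a ∈ A → b ∈ A → ¬ P a b

HasWidth : ∀ {n} → Rel n → ℕ → Set
HasWidth {n} P w =
  (∃ λ (A : Subset n) → IsAntichain P A × ∣ A ∣ ≡ w) ×
  (∀ (A : Subset n) → IsAntichain P A → ∣ A ∣ ≤ w)

Cover : ∀ {n} → Rel n → Rel n
Cover {n} P a b = P a b × (∀ (c : Fin n) → ¬ (P a c × P c b))

Between : ∀ {n} → Rel n → Fin n → Fin n → Fin n → Set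
Between σ u v x = (σ u x × σ x v) ⊎ (σ v x × σ x u)

NestedIn : ∀ {n} → Rel n → Fin n → Fin n → Fin n → Fin n → Set
NestedIn σ x y u v = Between σ u v x × Between σ u v y

Nest : ∀ {n} → Rel n → Fin n → Fin n → Fin n → Fin n → Set
Nest σ a b c d = NestedIn σ a b c d ⊎ NestedIn σ c d a b

IsQueueLayout : ∀ {n} → Rel n → Rel n → (k : ℕ) → (Fin n → Fin n → Fin k) → Set
IsQueueLayout {n} P σ k q =
  ∀ (a b c d : Fin n) → Cover P a b → Cover P c d →
    q a b ≡ q c d → ¬ Nest σ a b c d

HasQueueLayout : ∀ {n} → Rel n → Rel n → ℕ → Set
HasQueueLayout {n} P σ k = ∃ λ (q : Fin n → Fin n → Fin k) → IsQueueLayout P σ k q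

{-# OPTIONS --safe #-}
-- For an element v let rank v be the size of a largest antichain whose last element in L₁ is v.
-- If x precedes y in L₁ but follows it in L₂, then x and y are incomparable and every element
-- of an antichain ending at x is incomparable to y, so rank x < rank y; consequently two elements
-- of equal rank that are ordered by L₁ are comparable in P. Put the cover edge a ≺ b into the queue
-- labelled (min (rank a) (rank b), rank b): since ranks lie in 1..w there are w(w+1)/2 labels, and a
-- cover edge c ≺ d nested in a ≺ b with the same label would force a < c < b in P.
module Submission where

open import Defs
open import Data.Nat using (ℕ; zero; suc; _*_; ⌊_/2⌋; _+_; _≤_; _<_; _⊔_; _⊓_; _∸_; z≤n; s≤s)
open import Data.Nat.Properties hiding (_≟_)
open import Data.Nat.Solver using (module +-*-Solver)
open import Data.Sum using (_⊎_; inj₁; inj₂)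
open import Data.Product using (_×_; _,_; proj₁; proj₂; ∃-syntax)
open import Data.Fin using (Fin; toℕ; fromℕ<; _≟_)
open import Data.Fin.Properties using (all?; toℕ-fromℕ<)
open import Data.Fin.Subset using (Subset; _∈_; _∉_; ∣_∣; _∪_; ⁅_⁆; inside; outside)
open import Data.Fin.Subset.Properties
  using (_∈?_; x∈⁅x⁆; x∈⁅y⁆⇒x≡y; ∣⁅x⁆∣≡1; x∈p∪q⁻; x∈p∪q⁺; p⊆p∪q; p⊂q⇒∣p∣<∣q∣)
open import Data.Vec using (_∷_; [])
open import Data.Empty using (⊥-elim)
open import Relation.Nullary using (¬_; Dec; yes; no)
open import Relation.Nullary.Decidable using (_×-dec_; _→-dec_; _⊎-dec_; ¬?)
open import Level using (0ℓ)
open import Relation.Unary using (Pred; Decidable)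
open import Relation.Binary.PropositionalEquality using (_≡_; refl; sym; trans; cong; subst; module ≡-Reasoning)
open import Relation.Binary.Structures using (IsStrictTotalOrder)
open import Relation.Binary.Definitions using (tri<; tri≈; tri>)

maxOver : ∀ n → (Subset n → ℕ) → ℕ
maxOver zero    f = f []
maxOver (suc n) f = maxOver n (λ A → f (inside ∷ A)) ⊔ maxOver n (λ A → f (outside ∷ A))

≤-maxOver : ∀ n (f : Subset n → ℕ) A → f A ≤ maxOver n f
≤-maxOver zero    f []            = ≤-refl
≤-maxOver (suc n) f (inside ∷ A)  = ≤-trans (≤-maxOver n _ A) (m≤m⊔n _ _)
≤-maxOver (suc n) f (outside ∷ A) = ≤-trans (≤-maxOver n _ A) (m≤n⊔m _ _)

maxOver-lub : ∀ n (f : Subset n → ℕ) {w} → (∀ A → f A ≤ w) → maxOver n f ≤ w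
maxOver-lub zero    f f≤w = f≤w []
maxOver-lub (suc n) f f≤w =
  ⊔-lub (maxOver-lub n _ (λ A → f≤w (inside ∷ A))) (maxOver-lub n _ (λ A → f≤w (outside ∷ A)))

maxOver-attained : ∀ n (f : Subset n → ℕ) → ∃[ A ] maxOver n f ≡ f A
maxOver-attained zero f = [] , refl
maxOver-attained (suc n) f
  with ⊔-sel (maxOver n (λ A → f (inside ∷ A))) (maxOver n (λ A → f (outside ∷ A)))
... | inj₁ eq = let A , eq′ = maxOver-attained n _ in inside ∷ A , trans eq eq′
... | inj₂ eq = let A , eq′ = maxOver-attained n _ in outside ∷ A , trans eq eq′

module MaxCard {n} {Q : Pred (Subset n) 0ℓ} (Q? : Decidable Q) where

  cardIf : Subset n → ℕ
  cardIf A with Q? A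
  ... | yes _ = ∣ A ∣
  ... | no  _ = 0

  maxCard : ℕ
  maxCard = maxOver n cardIf

  ∣∣≤maxCard : ∀ {A} → Q A → ∣ A ∣ ≤ maxCard
  ∣∣≤maxCard {A} QA with Q? A | ≤-maxOver n cardIf A
  ... | yes _ | A≤max = A≤max
  ... | no ¬QA | _    = ⊥-elim (¬QA QA)

  maxCard-lub : ∀ {w} → (∀ A → Q A → ∣ A ∣ ≤ w) → maxCard ≤ w
  maxCard-lub {w} bound = maxOver-lub n cardIf cardIf≤w
    where
    cardIf≤w : ∀ A → cardIf A ≤ w
    cardIf≤w A with Q? A
    ... | yes QA = bound A QA
    ... | no  _  = z≤n

  maxCard-attained : ∀ {A} → Q A → ∃[ B ] Q B × ∣ B ∣ ≡ maxCard
  maxCard-attained {A} QA with maxOver-attained n cardIf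
  ... | B , max≡ with Q? B
  ...   | yes QB = B , QB , sym max≡
  ...   | no  _  = A , QA , ≤-antisym (∣∣≤maxCard QA) (≤-trans (≤-reflexive max≡) z≤n)

tri : ℕ → ℕ
tri zero    = 0
tri (suc t) = tri t + suc t

tri-mono-≤ : ∀ {s t} → s ≤ t → tri s ≤ tri t
tri-mono-≤ {zero}          _         = z≤n
tri-mono-≤ {suc s} {suc t} (s≤s s≤t) = +-mono-≤ (tri-mono-≤ s≤t) (s≤s s≤t)

tri+tri≡n*[1+n] : ∀ n → tri n + tri n ≡ n * suc n
tri+tri≡n*[1+n] zero    = refl
tri+tri≡n*[1+n] (suc n) = begin
  (tri n + suc n) + (tri n + suc n) ≡⟨ regroup (tri n) n ⟩
  (tri n + tri n) + 2 * suc n       ≡⟨ cong (_+ 2 * suc n) (tri+tri≡n*[1+n] n) ⟩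
  n * suc n + 2 * suc n             ≡⟨ expand n ⟩
  suc n * suc (suc n)               ∎
  where
  open ≡-Reasoning
  open +-*-Solver
  regroup : ∀ t n → (t + suc n) + (t + suc n) ≡ (t + t) + 2 * suc n
  regroup = solve 2 (λ t n → (t :+ (con 1 :+ n)) :+ (t :+ (con 1 :+ n))
                           := (t :+ t) :+ con 2 :* (con 1 :+ n)) refl
  expand : ∀ n → n * suc n + 2 * suc n ≡ suc n * suc (suc n)
  expand = solve 1 (λ n → n :* (con 1 :+ n) :+ con 2 :* (con 1 :+ n)
                       := (con 1 :+ n) :* (con 2 :+ n)) refl

tri≡⌊n*[1+n]/2⌋ : ∀ n → tri n ≡ ⌊ n * suc n /2⌋
tri≡⌊n*[1+n]/2⌋ n = trans (n≡⌊n+n/2⌋ (tri n)) (cong ⌊_/2⌋ (tri+tri≡n*[1+n] n))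

-- tri t + s enumerates the pairs s ≤ t row by row.
tri+-< : ∀ {s t w} → s ≤ t → t < w → tri t + s < tri w
tri+-< {s} {t} s≤t t<w = begin-strict
  tri t + s     <⟨ +-monoʳ-< (tri t) (s≤s s≤t) ⟩
  tri t + suc t ≤⟨ tri-mono-≤ t<w ⟩
  _             ∎
  where open ≤-Reasoning

tri+-injective : ∀ {s t s′ t′} → s ≤ t → s′ ≤ t′ → tri t + s ≡ tri t′ + s′ → s ≡ s′ × t ≡ t′
tri+-injective {s} {t} {s′} {t′} s≤t s′≤t′ eq with <-cmp t t′
... | tri≈ _ refl _ = +-cancelˡ-≡ (tri t) s s′ eq , refl
... | tri< t<t′ _ _ = ⊥-elim (<-irrefl eq (<-≤-trans (tri+-< s≤t t<t′) (m≤m+n (tri t′) s′)))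
... | tri> _ _ t′<t = ⊥-elim (<-irrefl (sym eq) (<-≤-trans (tri+-< s′≤t′ t′<t) (m≤m+n (tri t) s)))

module TwoDimensional {n} {P L₁ L₂ : Rel n} (realizer : IsRealizer P L₁ L₂) where

  private
    module L₁ = IsStrictTotalOrder (proj₁ (proj₁ realizer))
    module L₂ = IsStrictTotalOrder (proj₁ (proj₁ (proj₂ realizer)))

  P⇒L₁ : ∀ {a b} → P a b → L₁ a b
  P⇒L₁ {a} {b} p = proj₁ (proj₁ (proj₂ (proj₂ realizer) a b) p)

  P⇒L₂ : ∀ {a b} → P a b → L₂ a b
  P⇒L₂ {a} {b} p = proj₂ (proj₁ (proj₂ (proj₂ realizer) a b) p)

  L₁×L₂⇒P : ∀ {a b} → L₁ a b → L₂ a b → P a b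
  L₁×L₂⇒P {a} {b} l₁ l₂ = proj₂ (proj₂ (proj₂ realizer) a b) (l₁ , l₂)

  P-trans : ∀ {a b c} → P a b → P b c → P a c
  P-trans p q = L₁×L₂⇒P (L₁.trans (P⇒L₁ p) (P⇒L₁ q)) (L₂.trans (P⇒L₂ p) (P⇒L₂ q))

  L₁-asym : ∀ {a b} → L₁ a b → ¬ L₁ b a
  L₁-asym p q = L₁.irrefl refl (L₁.trans p q)

  L₂-asym : ∀ {a b} → L₂ a b → ¬ L₂ b a
  L₂-asym p q = L₂.irrefl refl (L₂.trans p q)

  P? : ∀ a b → Dec (P a b)
  P? a b with a L₁.<? b | a L₂.<? b
  ... | yes l₁ | yes l₂ = yes (L₁×L₂⇒P l₁ l₂)
  ... | no ¬l₁ | _      = no (λ p → ¬l₁ (P⇒L₁ p))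
  ... | _      | no ¬l₂ = no (λ p → ¬l₂ (P⇒L₂ p))

  incomparable⇒L₂-reversed : ∀ {u v} → L₁ u v → ¬ P u v → L₂ v u
  incomparable⇒L₂-reversed {u} {v} l₁ ¬p with L₂.compare u v
  ... | tri< l₂ _ _   = ⊥-elim (¬p (L₁×L₂⇒P l₁ l₂))
  ... | tri≈ _ refl _ = ⊥-elim (L₁.irrefl refl l₁)
  ... | tri> _ _ l₂   = l₂

  IsAntichainEndingAt : Fin n → Subset n → Set
  IsAntichainEndingAt v A = IsAntichain P A × v ∈ A × (∀ u → u ∈ A → u ≡ v ⊎ L₁ u v)

  isAntichainEndingAt? : ∀ v → Decidable (IsAntichainEndingAt v)
  isAntichainEndingAt? v A =
    all? (λ a → all? (λ b → (a ∈? A) →-dec ((b ∈? A) →-dec ¬? (P? a b))))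
    ×-dec (v ∈? A)
    ×-dec all? (λ u → (u ∈? A) →-dec ((u ≟ v) ⊎-dec (u L₁.<? v)))

  module _ (v : Fin n) where
    open MaxCard (isAntichainEndingAt? v) public
      using (∣∣≤maxCard; maxCard-lub; maxCard-attained)
      renaming (maxCard to rank)

  singleton-isAntichainEndingAt : ∀ v → IsAntichainEndingAt v ⁅ v ⁆
  singleton-isAntichainEndingAt v =
    (λ a b a∈ b∈ p → L₁.irrefl (trans (x∈⁅y⁆⇒x≡y v a∈) (sym (x∈⁅y⁆⇒x≡y v b∈))) (P⇒L₁ p))
    , x∈⁅x⁆ v , (λ u u∈ → inj₁ (x∈⁅y⁆⇒x≡y v u∈))

  rank-positive : ∀ v → 1 ≤ rank v
  rank-positive v = subst (_≤ rank v) (∣⁅x⁆∣≡1 v) (∣∣≤maxCard v (singleton-isAntichainEndingAt v))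

  rank≤width : ∀ {w} → (∀ A → IsAntichain P A → ∣ A ∣ ≤ w) → ∀ v → rank v ≤ w
  rank≤width bound v = maxCard-lub v (λ A (antichain , _) → bound A antichain)

  antichain-extends : ∀ {x y A} → L₁ x y → L₂ y x →
                      IsAntichainEndingAt x A → IsAntichainEndingAt y (A ∪ ⁅ y ⁆)
  antichain-extends {x} {y} {A} l₁ l₂ (antichain , x∈A , ends) =
    antichain′ , x∈p∪q⁺ (inj₂ (x∈⁅x⁆ y)) , ends′
    where
    before-y : ∀ {u} → u ∈ A → L₁ u y × L₂ y u
    before-y {u} u∈ with ends u u∈
    ... | inj₁ refl = l₁ , l₂
    ... | inj₂ u<x  = L₁.trans u<x l₁ , L₂.trans l₂ (incomparable⇒L₂-reversed u<x (antichain u x u∈ x∈A))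

    ∈A∪y : ∀ {u} → u ∈ A ∪ ⁅ y ⁆ → u ∈ A ⊎ u ≡ y
    ∈A∪y u∈ with x∈p∪q⁻ A ⁅ y ⁆ u∈
    ... | inj₁ u∈A = inj₁ u∈A
    ... | inj₂ u∈y = inj₂ (x∈⁅y⁆⇒x≡y y u∈y)

    antichain′ : IsAntichain P (A ∪ ⁅ y ⁆)
    antichain′ a b a∈ b∈ p with ∈A∪y a∈ | ∈A∪y b∈
    ... | inj₁ a∈A | inj₁ b∈A = antichain a b a∈A b∈A p
    ... | inj₁ a∈A | inj₂ refl = L₂-asym (P⇒L₂ p) (proj₂ (before-y a∈A))
    ... | inj₂ refl | inj₁ b∈A = L₁-asym (P⇒L₁ p) (proj₁ (before-y b∈A))
    ... | inj₂ refl | inj₂ refl = L₁.irrefl refl (P⇒L₁ p)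

    ends′ : ∀ u → u ∈ A ∪ ⁅ y ⁆ → u ≡ y ⊎ L₁ u y
    ends′ u u∈ with ∈A∪y u∈
    ... | inj₁ u∈A = inj₂ (proj₁ (before-y u∈A))
    ... | inj₂ u≡y = inj₁ u≡y

  rank-increasing : ∀ {x y} → L₁ x y → L₂ y x → rank x < rank y
  rank-increasing {x} {y} l₁ l₂ with maxCard-attained x (singleton-isAntichainEndingAt x)
  ... | A , endsAtX@(_ , _ , ends) , ∣A∣≡rank = begin-strict
    rank x          ≡⟨ sym ∣A∣≡rank ⟩
    ∣ A ∣           <⟨ p⊂q⇒∣p∣<∣q∣ (p⊆p∪q ⁅ y ⁆ , y , x∈p∪q⁺ (inj₂ (x∈⁅x⁆ y)) , y∉A) ⟩
    ∣ A ∪ ⁅ y ⁆ ∣   ≤⟨ ∣∣≤maxCard y (antichain-extends l₁ l₂ endsAtX) ⟩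
    rank y          ∎
    where
    open ≤-Reasoning
    y∉A : y ∉ A
    y∉A y∈A with ends y y∈A
    ... | inj₁ refl = L₁.irrefl refl l₁
    ... | inj₂ y<x  = L₁-asym l₁ y<x

  equal-rank⇒P : ∀ {x y} → L₁ x y → rank x ≡ rank y → P x y
  equal-rank⇒P {x} {y} l₁ eq with L₂.compare x y
  ... | tri< l₂ _ _   = L₁×L₂⇒P l₁ l₂
  ... | tri≈ _ refl _ = ⊥-elim (L₁.irrefl refl l₁)
  ... | tri> _ _ l₂   = ⊥-elim (<-irrefl eq (rank-increasing l₁ l₂))

  between-cover : ∀ {a b z} → Cover P a b → Between L₁ a b z → L₁ a z × L₁ z b
  between-cover _         (inj₁ a<z<b)       = a<z<b
  between-cover (a<b , _) (inj₂ (b<z , z<a)) = ⊥-elim (L₁-asym (P⇒L₁ a<b) (L₁.trans b<z z<a))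

  equal-labels⇒¬NestedIn : ∀ {a b c d} → Cover P a b → Cover P c d →
                           rank a ⊓ rank b ≡ rank c ⊓ rank d → rank b ≡ rank d →
                           ¬ NestedIn L₁ c d a b
  equal-labels⇒¬NestedIn {a} {b} {c} {d} cover-ab@(_ , covers) (c<d , _) min≡ b≡d (c∈ab , d∈ab) =
    covers c (a<c , P-trans c<d d<b)
    where
    a<₁c : L₁ a c
    a<₁c = proj₁ (between-cover cover-ab c∈ab)
    a<₁d : L₁ a d
    a<₁d = proj₁ (between-cover cover-ab d∈ab)
    d<b : P d b
    d<b = equal-rank⇒P (proj₂ (between-cover cover-ab d∈ab)) (sym b≡d)
    a<d : rank a < rank d
    a<d = rank-increasing a<₁d (incomparable⇒L₂-reversed a<₁d (λ a<d → covers d (a<d , d<b)))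
    min-ab : rank a ⊓ rank b ≡ rank a
    min-ab = m≤n⇒m⊓n≡m (<⇒≤ (subst (rank a <_) (sym b≡d) a<d))
    c≡a : rank c ≡ rank a
    c≡a with ≤-total (rank c) (rank d)
    ... | inj₁ c≤d = trans (sym (m≤n⇒m⊓n≡m c≤d)) (trans (sym min≡) min-ab)
    ... | inj₂ d≤c = ⊥-elim (<-irrefl (trans (sym min-ab) (trans min≡ (m≥n⇒m⊓n≡n d≤c))) a<d)
    a<c : P a c
    a<c = equal-rank⇒P a<₁c (sym c≡a)

  module Layout {w} (width : ∀ A → IsAntichain P A → ∣ A ∣ ≤ w) where

    lower upper : Fin n → Fin n → ℕ
    lower a b = rank a ⊓ rank b ∸ 1
    upper a b = rank b ∸ 1

    lower≤upper : ∀ a b → lower a b ≤ upper a b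
    lower≤upper a b = ∸-monoˡ-≤ 1 (m⊓n≤n (rank a) (rank b))

    upper<w : ∀ a b → upper a b < w
    upper<w a b = ∸-monoˡ-< (s≤s (rank≤width width b)) (rank-positive b)

    queue : Fin n → Fin n → Fin ⌊ w * suc w /2⌋
    queue a b = fromℕ< (subst (tri (upper a b) + lower a b <_) (tri≡⌊n*[1+n]/2⌋ w)
                              (tri+-< (lower≤upper a b) (upper<w a b)))

    queue-injective : ∀ {a b c d} → queue a b ≡ queue c d →
                      rank a ⊓ rank b ≡ rank c ⊓ rank d × rank b ≡ rank d
    queue-injective {a} {b} {c} {d} eq
      with tri+-injective (lower≤upper a b) (lower≤upper c d)
             (trans (sym (toℕ-fromℕ< _)) (trans (cong toℕ eq) (toℕ-fromℕ< _)))
    ... | lower≡ , upper≡ =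
      ∸-cancelʳ-≡ (⊓-glb (rank-positive a) (rank-positive b))
                  (⊓-glb (rank-positive c) (rank-positive d)) lower≡ ,
      ∸-cancelʳ-≡ (rank-positive b) (rank-positive d) upper≡

    isQueueLayout : IsQueueLayout P L₁ ⌊ w * suc w /2⌋ queue
    isQueueLayout a b c d cover-ab cover-cd eq nest with queue-injective eq | nest
    ... | min≡ , b≡d | inj₁ ab⊂cd = equal-labels⇒¬NestedIn cover-cd cover-ab (sym min≡) (sym b≡d) ab⊂cd
    ... | min≡ , b≡d | inj₂ cd⊂ab = equal-labels⇒¬NestedIn cover-ab cover-cd min≡ b≡d cd⊂ab

theorem2 : ∀ (n : ℕ) (P L₁ L₂ : Rel n) (w : ℕ) →
    IsPoset P → IsRealizer P L₁ L₂ → HasWidth P w →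
    HasQueueLayout P L₁ ⌊ w * suc w /2⌋ ⊎ HasQueueLayout P L₂ ⌊ w * suc w /2⌋
theorem2 n P L₁ L₂ w _ realizer (_ , width) = inj₁ (queue , isQueueLayout)
  where open TwoDimensional realizer using (module Layout)
        open Layout width
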